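{- For every sentence $\phi$, if $\vdash\phi$ in $\mathsf{FOFS}$, then $\vdash\Box\phi$ in $\mathsf{FOFS}$.
   Context: Over a signature with countably infinitely many constants and countably many predicate symbols, formulas are built from $P(\bar t)$, $s\doteq t$, $\land,\lor,\to,\Box,\Diamond,\forall x,\exists x,\bot$; $\top:=\bot\to\bot$. $\mathsf{FOFS}$ is the Hilbert system on sentences with axioms: substitution instances of intuitionistic propositional tautologies; $\Box(\phi\land\psi)\leftrightarrow(\Box\phi\land\Box\psi)$; $\Box\top$; $\Diamond(\phi\lor\psi)\leftrightarrow(\Diamond\phi\lor\Diamond\psi)$; $\neg\Diamond\bot$; $(\Diamond\phi\to\Box\psi)\to\Box(\phi\to\psi)$; $\Diamond(\phi\to\psi)\to(\Box\phi\to\Diamond\psi)$; $\forall x\phi(x)\to\phi(c)$; $\phi(c)\to\exists x\phi(x)$; $\forall x(\phi(x)\to\psi)\to(\exists x\phi(x)\to\psi)$; $\forall x(\phi\to\psi(x))\to(\phi\to\forall x\psi(x))$; $c\doteq c$; $c_1\doteq c_2\to(\phi(c_1)\to\phi(c_2))$ for modal-free $\phi$; rules modus ponens, from $\phi(c)$ infer $\forall x\phi(x)$, and from $\phi\to\psi$ infer $\Box\phi\to\Box\psi$ and $\Diamond\phi\to\Diamond\psi$. -}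

module Defs where

open import Data.Nat using (ℕ; _≟_)
open import Data.List using (List; []; _∷_)
open import Data.List.Membership.Propositional using (_∈_)
open import Data.Unit using (⊤; tt)
open import Data.Empty using (⊥)
open import Data.Product using (_×_)
open import Relation.Nullary using (¬_; yes; no)
open import Relation.Binary.PropositionalEquality using (_≡_)

data Term : Set where
  var : ℕ → Term
  con : ℕ → Term

infixr 6 _∧'_
infixr 5 _∨'_
infixr 4 _⇒_

data Formula : Set where
  pred : ℕ → List Term → Formula
  _≐_  : Term → Term → Formula
  _∧'_ : Formula → Formula → Formula
  _∨'_ : Formula → Formula → Formula
  _⇒_  : Formula → Formula → Formula
  □    : Formula → Formula
  ◇    : Formula → Formula
  ∀'   : ℕ → Formula → Formula
  ∃'   : ℕ → Formula → Formula
  ⊥'   : Formula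

⊤' : Formula
⊤' = ⊥' ⇒ ⊥'

¬' : Formula → Formula
¬' φ = φ ⇒ ⊥'

_⇔_ : Formula → Formula → Formula
φ ⇔ ψ = (φ ⇒ ψ) ∧' (ψ ⇒ φ)

TermClosedIn : List ℕ → Term → Set
TermClosedIn xs (var x) = x ∈ xs
TermClosedIn xs (con c) = ⊤

TermsClosedIn : List ℕ → List Term → Set
TermsClosedIn xs []       = ⊤
TermsClosedIn xs (t ∷ ts) = TermClosedIn xs t × TermsClosedIn xs ts

ClosedIn : List ℕ → Formula → Set
ClosedIn xs (pred P ts) = TermsClosedIn xs ts
ClosedIn xs (s ≐ t)     = TermClosedIn xs s × TermClosedIn xs t
ClosedIn xs (φ ∧' ψ)    = ClosedIn xs φ × ClosedIn xs ψ
ClosedIn xs (φ ∨' ψ)    = ClosedIn xs φ × ClosedIn xs ψ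
ClosedIn xs (φ ⇒ ψ)     = ClosedIn xs φ × ClosedIn xs ψ
ClosedIn xs (□ φ)       = ClosedIn xs φ
ClosedIn xs (◇ φ)       = ClosedIn xs φ
ClosedIn xs (∀' x φ)    = ClosedIn (x ∷ xs) φ
ClosedIn xs (∃' x φ)    = ClosedIn (x ∷ xs) φ
ClosedIn xs ⊥'          = ⊤

Sentence : Formula → Set
Sentence φ = ClosedIn [] φ

TermAvoids : ℕ → Term → Set
TermAvoids c (var x) = ⊤
TermAvoids c (con d) = ¬ (c ≡ d)

TermsAvoid : ℕ → List Term → Set
TermsAvoid c []       = ⊤
TermsAvoid c (t ∷ ts) = TermAvoids c t × TermsAvoid c ts

Avoids : ℕ → Formula → Set
Avoids c (pred P ts) = TermsAvoid c ts
Avoids c (s ≐ t)     = TermAvoids c s × TermAvoids c t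
Avoids c (φ ∧' ψ)    = Avoids c φ × Avoids c ψ
Avoids c (φ ∨' ψ)    = Avoids c φ × Avoids c ψ
Avoids c (φ ⇒ ψ)     = Avoids c φ × Avoids c ψ
Avoids c (□ φ)       = Avoids c φ
Avoids c (◇ φ)       = Avoids c φ
Avoids c (∀' x φ)    = Avoids c φ
Avoids c (∃' x φ)    = Avoids c φ
Avoids c ⊥'          = ⊤

ModalFree : Formula → Set
ModalFree (pred P ts) = ⊤
ModalFree (s ≐ t)     = ⊤
ModalFree (φ ∧' ψ)    = ModalFree φ × ModalFree ψ
ModalFree (φ ∨' ψ)    = ModalFree φ × ModalFree ψ
ModalFree (φ ⇒ ψ)     = ModalFree φ × ModalFree ψ
ModalFree (□ φ)       = ⊥
ModalFree (◇ φ)       = ⊥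
ModalFree (∀' x φ)    = ModalFree φ
ModalFree (∃' x φ)    = ModalFree φ
ModalFree ⊥'          = ⊤

-- Substitution of a constant c for the free occurrences of variable x:
-- φ [ c / x ] is  φ(c)  when φ = φ(x).  (No capture can occur, since
-- only constants are substituted.)

substT : Term → ℕ → ℕ → Term
substT (var y) c x with y ≟ x
... | yes _ = con c
... | no  _ = var y
substT (con d) c x = con d

substTs : List Term → ℕ → ℕ → List Term
substTs []       c x = []
substTs (t ∷ ts) c x = substT t c x ∷ substTs ts c x

_[_/_] : Formula → ℕ → ℕ → Formula
pred P ts [ c / x ] = pred P (substTs ts c x)
(s ≐ t)   [ c / x ] = substT s c x ≐ substT t c x
(φ ∧' ψ)  [ c / x ] = (φ [ c / x ]) ∧' (ψ [ c / x ])
(φ ∨' ψ)  [ c / x ] = (φ [ c / x ]) ∨' (ψ [ c / x ])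
(φ ⇒ ψ)   [ c / x ] = (φ [ c / x ]) ⇒ (ψ [ c / x ])
□ φ       [ c / x ] = □ (φ [ c / x ])
◇ φ       [ c / x ] = ◇ (φ [ c / x ])
∀' y φ    [ c / x ] with y ≟ x
... | yes _ = ∀' y φ
... | no  _ = ∀' y (φ [ c / x ])
∃' y φ    [ c / x ] with y ≟ x
... | yes _ = ∃' y φ
... | no  _ = ∃' y (φ [ c / x ])
⊥'        [ c / x ] = ⊥'

data PForm : Set where
  atom : ℕ → PForm
  p⊥   : PForm
  _p∧_ : PForm → PForm → PForm
  _p∨_ : PForm → PForm → PForm
  _p⇒_ : PForm → PForm → PForm

infixr 4 _p⇒_

data IPC : PForm → Set where
  ax-K    : ∀ A B → IPC (A p⇒ (B p⇒ A))
  ax-S    : ∀ A B C → IPC ((A p⇒ (B p⇒ C)) p⇒ ((A p⇒ B) p⇒ (A p⇒ C)))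
  ax-∧I   : ∀ A B → IPC (A p⇒ (B p⇒ (A p∧ B)))
  ax-∧E₁  : ∀ A B → IPC ((A p∧ B) p⇒ A)
  ax-∧E₂  : ∀ A B → IPC ((A p∧ B) p⇒ B)
  ax-∨I₁  : ∀ A B → IPC (A p⇒ (A p∨ B))
  ax-∨I₂  : ∀ A B → IPC (B p⇒ (A p∨ B))
  ax-∨E   : ∀ A B C → IPC ((A p⇒ C) p⇒ ((B p⇒ C) p⇒ ((A p∨ B) p⇒ C)))
  ax-⊥E   : ∀ A → IPC (p⊥ p⇒ A)
  mp      : ∀ {A B} → IPC (A p⇒ B) → IPC A → IPC B

inst : (ℕ → Formula) → PForm → Formula
inst σ (atom n) = σ n
inst σ p⊥       = ⊥'
inst σ (A p∧ B) = inst σ A ∧' inst σ B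
inst σ (A p∨ B) = inst σ A ∨' inst σ B
inst σ (A p⇒ B) = inst σ A ⇒ inst σ B

-- The Hilbert system FOFS on sentences.  Every axiom instance is
-- required to be a sentence; the rules preserve sentencehood (the
-- generalisation rule carries it as a side condition).

data ⊢_ : Formula → Set where
  taut   : ∀ A σ → IPC A → Sentence (inst σ A) → ⊢ inst σ A
  □∧     : ∀ φ ψ → Sentence φ → Sentence ψ → ⊢ (□ (φ ∧' ψ) ⇔ (□ φ ∧' □ ψ))
  □⊤     : ⊢ □ ⊤'
  ◇∨     : ∀ φ ψ → Sentence φ → Sentence ψ → ⊢ (◇ (φ ∨' ψ) ⇔ (◇ φ ∨' ◇ ψ))
  ¬◇⊥    : ⊢ ¬' (◇ ⊥')
  ◇□⇒    : ∀ φ ψ → Sentence φ → Sentence ψ → ⊢ ((◇ φ ⇒ □ ψ) ⇒ □ (φ ⇒ ψ))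
  ◇⇒□    : ∀ φ ψ → Sentence φ → Sentence ψ → ⊢ (◇ (φ ⇒ ψ) ⇒ (□ φ ⇒ ◇ ψ))
  ∀E     : ∀ x φ c → Sentence (∀' x φ) → ⊢ (∀' x φ ⇒ (φ [ c / x ]))
  ∃I     : ∀ x φ c → Sentence (∃' x φ) → ⊢ ((φ [ c / x ]) ⇒ ∃' x φ)
  ∀∃     : ∀ x φ ψ → Sentence (∃' x φ) → Sentence ψ →
           ⊢ (∀' x (φ ⇒ ψ) ⇒ (∃' x φ ⇒ ψ))
  ∀⇒     : ∀ x φ ψ → Sentence φ → Sentence (∀' x ψ) →
           ⊢ (∀' x (φ ⇒ ψ) ⇒ (φ ⇒ ∀' x ψ))
  refl≐  : ∀ c → ⊢ (con c ≐ con c)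
  subst≐ : ∀ x φ c₁ c₂ → ModalFree φ → Sentence (∀' x φ) →
           ⊢ ((con c₁ ≐ con c₂) ⇒ ((φ [ c₁ / x ]) ⇒ (φ [ c₂ / x ])))
  mp     : ∀ {φ ψ} → ⊢ (φ ⇒ ψ) → ⊢ φ → ⊢ ψ
  gen    : ∀ x φ c → Avoids c φ → Sentence (∀' x φ) →
           ⊢ (φ [ c / x ]) → ⊢ ∀' x φ
  □mono  : ∀ {φ ψ} → ⊢ (φ ⇒ ψ) → ⊢ (□ φ ⇒ □ ψ)
  ◇mono  : ∀ {φ ψ} → ⊢ (φ ⇒ ψ) → ⊢ (◇ φ ⇒ ◇ ψ)

module Submission where

open import Defs
open import Data.Nat using (ℕ; zero; suc)
open import Data.Unit using (tt)
open import Data.Product using (_,_)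

atoms₂ : Formula → Formula → ℕ → Formula
atoms₂ φ ψ zero    = φ
atoms₂ φ ψ (suc _) = ψ

⊢-K : ∀ φ ψ → Sentence φ → Sentence ψ → ⊢ (φ ⇒ (ψ ⇒ φ))
⊢-K φ ψ sφ sψ =
  taut (atom 0 p⇒ (atom 1 p⇒ atom 0)) (atoms₂ φ ψ) (ax-K (atom 0) (atom 1)) (sφ , sψ , sφ)

⊢-weaken : ∀ {φ} ψ → Sentence φ → Sentence ψ → ⊢ φ → ⊢ (ψ ⇒ φ)
⊢-weaken {φ} ψ sφ sψ ⊢φ = mp (⊢-K φ ψ sφ sψ) ⊢φ

mainTheorem15 : (φ : Formula) → Sentence φ → ⊢ φ → ⊢ □ φ
mainTheorem15 φ sφ ⊢φ = mp (□mono (⊢-weaken ⊤' sφ (tt , tt) ⊢φ)) □⊤
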